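{- Let $H$ and $H'$ be the encodings of Hydras at stages $n$ and $n+1$ in a battle. Then (1) $H=\mathsf{I}(\mathsf{h})$ and $H'=\mathsf{h}$, or (2) $H=_{\mathrm{AC}}\mathsf{I}(\mathsf{h}\mid t)$ and $H'=\mathsf{I}(t)$ for some term $t$, or (3) $H\to_{\mathcal{R}_n/\mathrm{AC}}H'$.
   Context: Terms are built over $\{\mathsf{h},\mathsf{I},\mid\}$ ($\mathsf{h}$ constant, $\mathsf{I}$ unary, $\mid$ binary written infix) and variables; $=_{\mathrm{AC}}$ is the congruence generated by associativity and commutativity of $\mid$. For a TRS $\mathcal{R}$, $\to_{\mathcal{R}/\mathrm{AC}}={=_{\mathrm{AC}}}\cdot{\to_{\mathcal{R}}}\cdot{=_{\mathrm{AC}}}$, where $\to_{\mathcal{R}}$ is the closure of $\mathcal{R}$ under substitutions and contexts. For a term $t$ and $k\ge1$, $t^1=t$ and $t^k=t^{k-1}\mid t$ for $k>1$. For $n\in\mathbb{N}$, $\mathcal{R}_n$ consists of the four rules $\mathsf{I}(\mathsf{I}(\mathsf{h}))\to\mathsf{I}(\mathsf{h}^{n+2})$, $\mathsf{I}(\mathsf{I}(\mathsf{h}\mid x))\to\mathsf{I}(\mathsf{I}(x)^{n+2})$, $\mathsf{I}(\mathsf{I}(\mathsf{h})\mid y)\to\mathsf{I}(\mathsf{h}^{n+2}\mid y)$, $\mathsf{I}(\mathsf{I}(\mathsf{h}\mid x)\mid y)\to\mathsf{I}(\mathsf{I}(x)^{n+2}\mid y)$. A Hydra is a finite rooted unordered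 tree; its heads are its leaves other than the root. Encoding: a single node is encoded as $\mathsf{h}$, and a node whose subtrees are $T_1,\dots,T_k$ ($k\ge1$) as $\mathsf{I}(t_1\mid\cdots\mid t_k)$ with $t_i$ an encoding of $T_i$. A battle step at stage $n$ transforms a Hydra $T$ with at least one head into $T'$: choose a head $\ell$ with parent $p$ and delete $\ell$; if $p$ is the root, the result is $T'$; otherwise, with $g$ the parent of $p$ and $P$ the subtree rooted at $p$ after deletion, $T'$ is obtained by replacing $P$, as a child subtree of $g$, by $n+2$ copies of $P$. In a battle $T_0,T_1,\dots$, $T_{n+1}$ arises from $T_n$ by a battle step at stage $n$; $T_n$ and $T_{n+1}$ are the Hydras at stages $n$ and $n+1$. -}

module Defs where

open import Data.Nat using (ℕ; zero; suc)
open import Data.List using (List; []; _∷_; _++_; replicate)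
open import Data.List.Relation.Binary.Permutation.Propositional using (_↭_)
open import Data.Product using (∃; _×_; _,_)

infixl 6 _∣_
data Term : Set where
  var : ℕ → Term
  h   : Term
  I   : Term → Term
  _∣_ : Term → Term → Term

-- pow t k  is  t^(k+1):  t^1 = t,  t^(k+1) = t^k ∣ t
pow : Term → ℕ → Term
pow t zero    = t
pow t (suc k) = pow t k ∣ t

-- t ^[ m ] for m ≥ 1 is written  pow t (m - 1); so t^(n+2) = pow t (suc n)

infix 4 _=AC_
data _=AC_ : Term → Term → Set where
  ac-refl  : ∀ {s} → s =AC s
  ac-sym   : ∀ {s t} → s =AC t → t =AC s
  ac-trans : ∀ {s t u} → s =AC t → t =AC u → s =AC u
  ac-assoc : ∀ {s t u} → (s ∣ t) ∣ u =AC s ∣ (t ∣ u)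
  ac-comm  : ∀ {s t} → s ∣ t =AC t ∣ s
  ac-I     : ∀ {s t} → s =AC t → I s =AC I t
  ac-∣     : ∀ {s s′ t t′} → s =AC s′ → t =AC t′ → s ∣ t =AC s′ ∣ t′

subst : (ℕ → Term) → Term → Term
subst σ (var x) = σ x
subst σ h       = h
subst σ (I t)   = I (subst σ t)
subst σ (s ∣ t) = subst σ s ∣ subst σ t

x y : Term
x = var 0
y = var 1

data Rule (n : ℕ) : Term → Term → Set where
  r1 : Rule n (I (I h))           (I (pow h (suc n)))
  r2 : Rule n (I (I (h ∣ x)))     (I (pow (I x) (suc n)))
  r3 : Rule n (I (I h ∣ y))       (I (pow h (suc n) ∣ y))
  r4 : Rule n (I (I (h ∣ x) ∣ y)) (I (pow (I x) (suc n) ∣ y))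

data Step (n : ℕ) : Term → Term → Set where
  root : ∀ {l r} (σ : ℕ → Term) → Rule n l r → Step n (subst σ l) (subst σ r)
  inI  : ∀ {s t} → Step n s t → Step n (I s) (I t)
  inL  : ∀ {s t u} → Step n s t → Step n (s ∣ u) (t ∣ u)
  inR  : ∀ {s t u} → Step n s t → Step n (u ∣ s) (u ∣ t)

StepAC : ℕ → Term → Term → Set
StepAC n s t = ∃ λ s′ → ∃ λ t′ → (s =AC s′) × Step n s′ t′ × (t′ =AC t)

-- Hydras: finite rooted trees (children as a list; unorderedness is
-- accounted for by allowing the encoding to permute children)

data Tree : Set where
  node : List Tree → Tree

leaf : Tree
leaf = node []

data Join : List Term → Term → Set where
  one   : ∀ {u} → Join (u ∷ []) u
  split : ∀ {us vs a b} → Join us a → Join vs b → Join (us ++ vs) (a ∣ b)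

mutual
  data Enc : Tree → Term → Set where
    enc-leaf : Enc leaf h
    enc-node : ∀ {T Ts Ss us t} → (T ∷ Ts) ↭ Ss → EncList Ss us →
               Join us t → Enc (node (T ∷ Ts)) (I t)

  data EncList : List Tree → List Term → Set where
    []  : EncList [] []
    _∷_ : ∀ {T Ts u us} → Enc T u → EncList Ts us → EncList (T ∷ Ts) (u ∷ us)

-- Grow n g g′ : g′ arises from the (sub)tree g by deleting a head ℓ whose
-- parent p is a child of some node g₀ inside g (g₀ = g or a descendant),
-- and replacing the resulting subtree P of p by n+2 copies of P.
data Grow (n : ℕ) : Tree → Tree → Set where
  here  : ∀ xs as bs ys →
          Grow n (node (xs ++ node (as ++ leaf ∷ bs) ∷ ys))
                 (node (xs ++ replicate (suc (suc n)) (node (as ++ bs)) ++ ys))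
  there : ∀ xs ys {c c′} → Grow n c c′ →
          Grow n (node (xs ++ c ∷ ys)) (node (xs ++ c′ ∷ ys))

data BattleStep (n : ℕ) : Tree → Tree → Set where
  cut-root : ∀ xs ys → BattleStep n (node (xs ++ leaf ∷ ys)) (node (xs ++ ys))
  cut-deep : ∀ {T T′} → Grow n T T′ → BattleStep n T T′

{-# OPTIONS --safe #-}
-- Encodings of a Hydra are unique up to AC, so it suffices to compare canonical encodings ⟦ T ⟧,
-- in which any chosen child may be moved to the front. A head cut at the root leaves I h ↦ h or
-- I (h ∣ t) ↦ I t. Otherwise let g be the grandparent of the head: up to AC the encoding of g is
-- I (I (h ∣ x) ∣ y), with the other children of the parent in x and those of g in y (either
-- possibly absent), and the step turns it into I (I x ^ (n+2) ∣ y), an instance of one of the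
-- four rules; above g the step is closed under contexts.
module Submission where

open import Defs
open import Data.Nat using (ℕ; suc)
open import Data.Product using (∃; ∃₂; _×_; _,_; proj₁; proj₂)
open import Data.Sum using (_⊎_; inj₁; inj₂)
open import Data.List using (List; []; _∷_; _++_; replicate)
open import Data.List.Properties using (++-identityʳ)
open import Data.List.Relation.Binary.Pointwise as Pointwise using (Pointwise; []; _∷_)
open import Data.List.Relation.Binary.Permutation.Propositional
  using (_↭_; refl; prep; swap; trans; ↭-sym)
open import Data.List.Relation.Binary.Permutation.Propositional.Properties
  using (↭-empty-inv; shift; shifts)
open import Relation.Binary.Bundles using (Setoid)
open import Relation.Binary.PropositionalEquality using (_≡_; refl; cong)
import Relation.Binary.Reasoning.Setoid as SetoidReasoning

=AC-setoid : Setoid _ _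
=AC-setoid = record
  { Carrier       = Term
  ; _≈_           = _=AC_
  ; isEquivalence = record { refl = ac-refl ; sym = ac-sym ; trans = ac-trans }
  }

open SetoidReasoning =AC-setoid

=AC-respects-h : ∀ {s t} → s =AC t → (s ≡ h → t ≡ h) × (t ≡ h → s ≡ h)
=AC-respects-h ac-refl       = (λ e → e) , (λ e → e)
=AC-respects-h (ac-sym p)    = proj₂ (=AC-respects-h p) , proj₁ (=AC-respects-h p)
=AC-respects-h (ac-trans p q) =
  (λ e → proj₁ (=AC-respects-h q) (proj₁ (=AC-respects-h p) e)) ,
  (λ e → proj₂ (=AC-respects-h p) (proj₂ (=AC-respects-h q) e))
=AC-respects-h ac-assoc      = (λ ()) , (λ ())
=AC-respects-h ac-comm       = (λ ()) , (λ ())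
=AC-respects-h (ac-I _)      = (λ ()) , (λ ())
=AC-respects-h (ac-∣ _ _)    = (λ ()) , (λ ())

=AC-h⇒≡h : ∀ {s} → s =AC h → s ≡ h
=AC-h⇒≡h p = proj₂ (=AC-respects-h p) refl

-- u₁ ∣ (u₂ ∣ (⋯ ∣ uₖ)); the value h at [] is junk, only nonempty lists are joined.
joinʳ : List Term → Term
joinʳ []           = h
joinʳ (u ∷ [])     = u
joinʳ (u ∷ v ∷ vs) = u ∣ joinʳ (v ∷ vs)

joinʳ-cong : ∀ {us vs} → Pointwise _=AC_ us vs → joinʳ us =AC joinʳ vs
joinʳ-cong []                = ac-refl
joinʳ-cong (p ∷ [])          = p
joinʳ-cong (p ∷ ps@(_ ∷ _))  = ac-∣ p (joinʳ-cong ps)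

joinʳ-∷-cong : ∀ u {us vs} → us ↭ vs → joinʳ us =AC joinʳ vs →
               joinʳ (u ∷ us) =AC joinʳ (u ∷ vs)
joinʳ-∷-cong u {[]}    p _ rewrite ↭-empty-inv (↭-sym p) = ac-refl
joinʳ-∷-cong u {_ ∷ _} {[]} p _ with () ← ↭-empty-inv p
joinʳ-∷-cong u {_ ∷ _} {_ ∷ _} _ q = ac-∣ ac-refl q

joinʳ-swap : ∀ u v ws → joinʳ (u ∷ v ∷ ws) =AC joinʳ (v ∷ u ∷ ws)
joinʳ-swap u v []       = ac-comm
joinʳ-swap u v (_ ∷ _)  = ac-trans (ac-sym ac-assoc) (ac-trans (ac-∣ ac-comm ac-refl) ac-assoc)

joinʳ-↭ : ∀ {us vs} → us ↭ vs → joinʳ us =AC joinʳ vs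
joinʳ-↭ refl            = ac-refl
joinʳ-↭ (prep u p)      = joinʳ-∷-cong u p (joinʳ-↭ p)
joinʳ-↭ (swap {xs = ws} u v p) =
  ac-trans (joinʳ-swap u v ws) (joinʳ-∷-cong v (prep u p) (joinʳ-∷-cong u p (joinʳ-↭ p)))
joinʳ-↭ (trans p q)     = ac-trans (joinʳ-↭ p) (joinʳ-↭ q)

joinʳ-++ : ∀ u us v vs → joinʳ ((u ∷ us) ++ v ∷ vs) =AC joinʳ (u ∷ us) ∣ joinʳ (v ∷ vs)
joinʳ-++ u []        v vs = ac-refl
joinʳ-++ u (u′ ∷ us) v vs = ac-trans (ac-∣ ac-refl (joinʳ-++ u′ us v vs)) (ac-sym ac-assoc)

Join-nonempty : ∀ {us t} → Join us t → ∃₂ λ u us′ → us ≡ u ∷ us′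
Join-nonempty one         = _ , _ , refl
Join-nonempty (split j _) with _ , _ , refl ← Join-nonempty j = _ , _ , refl

Join⇒=AC-joinʳ : ∀ {us t} → Join us t → t =AC joinʳ us
Join⇒=AC-joinʳ one = ac-refl
Join⇒=AC-joinʳ (split j k)
  with u , us , refl ← Join-nonempty j | v , vs , refl ← Join-nonempty k =
  ac-trans (ac-∣ (Join⇒=AC-joinʳ j) (Join⇒=AC-joinʳ k)) (ac-sym (joinʳ-++ u us v vs))

pow=AC-joinʳ-replicate : ∀ t k → pow t k =AC joinʳ (replicate (suc k) t)
pow=AC-joinʳ-replicate t 0       = ac-refl
pow=AC-joinʳ-replicate t (suc k) = ac-trans ac-comm (ac-∣ ac-refl (pow=AC-joinʳ-replicate t k))

branch : List Term → Term
branch []       = h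
branch (u ∷ us) = I (joinʳ (u ∷ us))

branch-↭ : ∀ {us vs} → us ↭ vs → branch us =AC branch vs
branch-↭ {[]}    p rewrite ↭-empty-inv (↭-sym p) = ac-refl
branch-↭ {_ ∷ _} {[]} p with () ← ↭-empty-inv p
branch-↭ {_ ∷ _} {_ ∷ _} p = ac-I (joinʳ-↭ p)

mutual
  ⟦_⟧ : Tree → Term
  ⟦ node Ts ⟧ = branch ⟦ Ts ⟧s

  ⟦_⟧s : List Tree → List Term
  ⟦ [] ⟧s     = []
  ⟦ T ∷ Ts ⟧s = ⟦ T ⟧ ∷ ⟦ Ts ⟧s

⟦⟧s-++ : ∀ Ts Ss → ⟦ Ts ++ Ss ⟧s ≡ ⟦ Ts ⟧s ++ ⟦ Ss ⟧s
⟦⟧s-++ []       Ss = refl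
⟦⟧s-++ (T ∷ Ts) Ss = cong (⟦ T ⟧ ∷_) (⟦⟧s-++ Ts Ss)

⟦⟧s-replicate : ∀ k T → ⟦ replicate k T ⟧s ≡ replicate k ⟦ T ⟧
⟦⟧s-replicate 0       T = refl
⟦⟧s-replicate (suc k) T = cong (⟦ T ⟧ ∷_) (⟦⟧s-replicate k T)

⟦⟧s-↭ : ∀ {Ts Ss} → Ts ↭ Ss → ⟦ Ts ⟧s ↭ ⟦ Ss ⟧s
⟦⟧s-↭ refl        = refl
⟦⟧s-↭ (prep T p)  = prep ⟦ T ⟧ (⟦⟧s-↭ p)
⟦⟧s-↭ (swap T S p) = swap ⟦ T ⟧ ⟦ S ⟧ (⟦⟧s-↭ p)
⟦⟧s-↭ (trans p q) = trans (⟦⟧s-↭ p) (⟦⟧s-↭ q)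

⟦node⟧-shift : ∀ Ts S Ss → ⟦ node (Ts ++ S ∷ Ss) ⟧ =AC I (joinʳ (⟦ S ⟧ ∷ ⟦ Ts ++ Ss ⟧s))
⟦node⟧-shift Ts S Ss = branch-↭ (⟦⟧s-↭ (shift S Ts Ss))

mutual
  Enc-node-inv : ∀ {T Ts H} → Enc (node (T ∷ Ts)) H →
                 ∃ λ t → H ≡ I t × t =AC joinʳ ⟦ T ∷ Ts ⟧s
  Enc-node-inv {T} {Ts} (enc-node {Ss = Ss} {us = us} {t = t} p Es j) = t , refl , (begin
    t                  ≈⟨ Join⇒=AC-joinʳ j ⟩
    joinʳ us           ≈⟨ joinʳ-cong (EncList⇒=AC Es) ⟩
    joinʳ ⟦ Ss ⟧s      ≈⟨ joinʳ-↭ (⟦⟧s-↭ (↭-sym p)) ⟩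
    joinʳ ⟦ T ∷ Ts ⟧s  ∎)

  Enc⇒=AC⟦⟧ : ∀ {T H} → Enc T H → H =AC ⟦ T ⟧
  Enc⇒=AC⟦⟧ enc-leaf = ac-refl
  Enc⇒=AC⟦⟧ E@(enc-node _ _ _) with _ , refl , t=AC ← Enc-node-inv E = ac-I t=AC

  EncList⇒=AC : ∀ {Ts us} → EncList Ts us → Pointwise _=AC_ us ⟦ Ts ⟧s
  EncList⇒=AC []       = []
  EncList⇒=AC (E ∷ Es) = Enc⇒=AC⟦⟧ E ∷ EncList⇒=AC Es

StepAC-resp : ∀ {n s s′ t′ t} → s =AC s′ → StepAC n s′ t′ → t′ =AC t → StepAC n s t
StepAC-resp p (a , b , q , st , r) r′ = a , b , ac-trans p q , st , ac-trans r r′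

StepAC-I : ∀ {n s t} → StepAC n s t → StepAC n (I s) (I t)
StepAC-I (a , b , p , st , q) = I a , I b , ac-I p , inI st , ac-I q

StepAC-joinʳ-∷ : ∀ {n s t} → StepAC n s t → ∀ us → StepAC n (joinʳ (s ∷ us)) (joinʳ (t ∷ us))
StepAC-joinʳ-∷ st                  []      = st
StepAC-joinʳ-∷ (a , b , p , st , q) (_ ∷ _) =
  a ∣ _ , b ∣ _ , ac-∣ p ac-refl , inL st , ac-∣ q ac-refl

Rule⇒StepAC : ∀ {n l r s t} (σ : ℕ → Term) → Rule n l r →
              s =AC subst σ l → subst σ r =AC t → StepAC n s t
Rule⇒StepAC σ ρ p q = _ , _ , p , root σ ρ , q

subst-pow : ∀ σ t k → subst σ (pow t k) ≡ pow (subst σ t) k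
subst-pow σ t 0       = refl
subst-pow σ t (suc k) = cong (_∣ subst σ t) (subst-pow σ t k)

⟨_,_⟩ : Term → Term → ℕ → Term
⟨ s , t ⟩ 0       = s
⟨ s , t ⟩ (suc _) = t

copies-alone : ∀ σ t k → subst σ (pow t k) =AC joinʳ (replicate (suc k) (subst σ t) ++ [])
copies-alone σ t k = begin
  subst σ (pow t k)                   ≡⟨ subst-pow σ t k ⟩
  pow u k                             ≈⟨ pow=AC-joinʳ-replicate u k ⟩
  joinʳ (replicate (suc k) u)         ≡⟨ cong joinʳ (++-identityʳ (replicate (suc k) u)) ⟨
  joinʳ (replicate (suc k) u ++ [])   ∎
  where u = subst σ t

copies-beside : ∀ σ t k c cs → subst σ (pow t k) ∣ joinʳ (c ∷ cs)
                               =AC joinʳ (replicate (suc k) (subst σ t) ++ c ∷ cs)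
copies-beside σ t k c cs = begin
  subst σ (pow t k) ∣ C                 ≡⟨ cong (_∣ C) (subst-pow σ t k) ⟩
  pow u k ∣ C                           ≈⟨ ac-∣ (pow=AC-joinʳ-replicate u k) ac-refl ⟩
  joinʳ (replicate (suc k) u) ∣ C       ≈⟨ joinʳ-++ u (replicate k u) c cs ⟨
  joinʳ (replicate (suc k) u ++ c ∷ cs) ∎
  where u = subst σ t
        C = joinʳ (c ∷ cs)

-- W encodes the other children of the head's parent P and C the siblings of P; the four rules
-- are the four cases of W and C being empty or not.
copy-step : ∀ n W C → StepAC n (I (joinʳ (I (joinʳ (h ∷ W)) ∷ C)))
                               (I (joinʳ (replicate (suc (suc n)) (branch W) ++ C)))
copy-step n []       []       = Rule⇒StepAC ⟨ h , h ⟩ r1 ac-refl (ac-I (copies-alone _ h (suc n)))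
copy-step n (w ∷ ws) []       =
  Rule⇒StepAC ⟨ joinʳ (w ∷ ws) , h ⟩ r2 ac-refl (ac-I (copies-alone _ (I x) (suc n)))
copy-step n []       (c ∷ cs) =
  Rule⇒StepAC ⟨ h , joinʳ (c ∷ cs) ⟩ r3 ac-refl (ac-I (copies-beside _ h (suc n) c cs))
copy-step n (w ∷ ws) (c ∷ cs) =
  Rule⇒StepAC ⟨ joinʳ (w ∷ ws) , joinʳ (c ∷ cs) ⟩ r4 ac-refl
              (ac-I (copies-beside _ (I x) (suc n) c cs))

Grow⇒StepAC : ∀ {n T T′} → Grow n T T′ → StepAC n ⟦ T ⟧ ⟦ T′ ⟧
Grow⇒StepAC {n} (here xs as bs ys) =
  StepAC-resp source (copy-step n ⟦ as ++ bs ⟧s ⟦ xs ++ ys ⟧s) target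
  where
  P   = node (as ++ bs)
  Ps  = replicate (suc (suc n)) P
  source : ⟦ node (xs ++ node (as ++ leaf ∷ bs) ∷ ys) ⟧
           =AC I (joinʳ (I (joinʳ (h ∷ ⟦ as ++ bs ⟧s)) ∷ ⟦ xs ++ ys ⟧s))
  source = begin
    ⟦ node (xs ++ node (as ++ leaf ∷ bs) ∷ ys) ⟧
      ≈⟨ ⟦node⟧-shift xs (node (as ++ leaf ∷ bs)) ys ⟩
    I (joinʳ (⟦ node (as ++ leaf ∷ bs) ⟧ ∷ ⟦ xs ++ ys ⟧s))
      ≈⟨ ac-I (joinʳ-cong (⟦node⟧-shift as leaf bs ∷ Pointwise.refl ac-refl {⟦ xs ++ ys ⟧s})) ⟩
    I (joinʳ (I (joinʳ (h ∷ ⟦ as ++ bs ⟧s)) ∷ ⟦ xs ++ ys ⟧s)) ∎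
  target : I (joinʳ (replicate (suc (suc n)) ⟦ P ⟧ ++ ⟦ xs ++ ys ⟧s)) =AC ⟦ node (xs ++ Ps ++ ys) ⟧
  target = begin
    I (joinʳ (replicate (suc (suc n)) ⟦ P ⟧ ++ ⟦ xs ++ ys ⟧s))
      ≡⟨ cong (λ us → I (joinʳ (us ++ ⟦ xs ++ ys ⟧s))) (⟦⟧s-replicate (suc (suc n)) P) ⟨
    I (joinʳ (⟦ Ps ⟧s ++ ⟦ xs ++ ys ⟧s))
      ≡⟨ cong (λ us → I (joinʳ us)) (⟦⟧s-++ Ps (xs ++ ys)) ⟨
    ⟦ node (Ps ++ xs ++ ys) ⟧
      ≈⟨ branch-↭ (⟦⟧s-↭ (shifts xs Ps)) ⟨
    ⟦ node (xs ++ Ps ++ ys) ⟧ ∎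
Grow⇒StepAC (there xs ys {c} {c′} g) =
  StepAC-resp (⟦node⟧-shift xs c ys)
              (StepAC-I (StepAC-joinʳ-∷ (Grow⇒StepAC g) ⟦ xs ++ ys ⟧s))
              (ac-sym (⟦node⟧-shift xs c′ ys))

Enc-single-leaf : ∀ {H} → Enc (node (leaf ∷ [])) H → H ≡ I h
Enc-single-leaf E with _ , refl , t=AC ← Enc-node-inv E = cong I (=AC-h⇒≡h t=AC)

cut-leaf-at-root : ∀ xs ys {T Ts H H′} → xs ++ ys ≡ T ∷ Ts →
                   Enc (node (xs ++ leaf ∷ ys)) H → Enc (node (T ∷ Ts)) H′ →
                   ∃ λ t → (H =AC I (h ∣ t)) × (H′ ≡ I t)
cut-leaf-at-root xs ys {T} {Ts} {H} eq E E′
  with t , refl , t=AC ← Enc-node-inv E′ = t , H=AC , refl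
  where
  H=AC : H =AC I (h ∣ t)
  H=AC = begin
    H                                   ≈⟨ Enc⇒=AC⟦⟧ E ⟩
    ⟦ node (xs ++ leaf ∷ ys) ⟧          ≈⟨ ⟦node⟧-shift xs leaf ys ⟩
    I (joinʳ (h ∷ ⟦ xs ++ ys ⟧s))       ≡⟨ cong (λ Ss → I (joinʳ (h ∷ ⟦ Ss ⟧s))) eq ⟩
    I (h ∣ joinʳ ⟦ T ∷ Ts ⟧s)           ≈⟨ ac-I (ac-∣ ac-refl t=AC) ⟨
    I (h ∣ t)                           ∎

lemma3p8 : ∀ (n : ℕ) {T T′ : Tree} {H H′ : Term} →
           BattleStep n T T′ → Enc T H → Enc T′ H′ →
           ((H ≡ I h) × (H′ ≡ h))
           ⊎ (∃ λ t → (H =AC I (h ∣ t)) × (H′ ≡ I t))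
           ⊎ StepAC n H H′
lemma3p8 n (cut-root [] [])       E enc-leaf = inj₁ (Enc-single-leaf E , refl)
lemma3p8 n (cut-root [] (y ∷ ys)) E E′ = inj₂ (inj₁ (cut-leaf-at-root [] (y ∷ ys) refl E E′))
lemma3p8 n (cut-root (x ∷ xs) ys) E E′ = inj₂ (inj₁ (cut-leaf-at-root (x ∷ xs) ys refl E E′))
lemma3p8 n (cut-deep g)           E E′ =
  inj₂ (inj₂ (StepAC-resp (Enc⇒=AC⟦⟧ E) (Grow⇒StepAC g) (ac-sym (Enc⇒=AC⟦⟧ E′))))
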